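{- Let $H_1=(A_1\cup B_1,E_1)$ and $H_2=(A_2\cup B_2,E_2)$ be balanced bipartite graphs with part sizes $n_1$ and $n_2$ respectively, regular of degrees $d_1$ and $d_2$ respectively, for positive integers $n_1,n_2,d_1,d_2$. Suppose each of $H_1$, $H_2$ is given in either a matching ordering or a comatching ordering. Then $H_1\bowtie H_2$ is a regular balanced bipartite graph with parts $A_1\times A_2$ and $B_1\times B_2$, each of size $n_1n_2$. If both $H_1$ and $H_2$ are given in matching ordering, then $H_1\bowtie H_2$ has degree $d_1+d_2-1$; otherwise it has degree $d_1+d_2$.
   Context: Graphs are finite and simple. A balanced bipartite graph $H=(A\cup B,E)$ with a given vertex ordering means labellings $A=\{a_1,\dots,a_n\}$, $B=\{b_1,\dots,b_n\}$. The ordering is a matching ordering if $a_ib_i\in E$ for all $i$, and a comatching ordering if $a_ib_i\notin E$ for all $i$. For balanced bipartite graphs $H_1=(A_1\cup B_1,E_1)$ and $H_2=(A_2\cup B_2,E_2)$ with given orderings $A_1=\{a^1_1,\dots,a^1_{n_1}\}$, $B_1=\{b^1_1,\dots,b^1_{n_1}\}$, $A_2=\{a^2_1,\dots,a^2_{n_2}\}$, $B_2=\{b^2_1,\dots,b^2_{n_2}\}$, the balanced bipartite product $H_1\bowtie H_2$ has vertex set $A_1\times A_2\cup B_1\times B_2$ and edge set $$\{(a^1_i,a^2)(b^1_i,b^2) : i\in\{1,\dots,n_1\},\ a^2b^2\in E_2\}\cup\{(a^1,a^2_j)(b^1,b^2_j) : a^1b^1\in E_1,\ j\in\{1,\dots,n_2\}\}.$$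 -}

module Defs where

open import Data.Nat using (ℕ; zero; suc; _+_)
open import Data.Bool using (Bool; true; false; _∧_; _∨_; if_then_else_)
open import Data.Fin using (Fin)
open import Data.Fin.Properties using (_≟_)
open import Data.List using (List; []; _∷_; allFin; cartesianProduct)
open import Data.Product using (_×_; _,_)
open import Relation.Binary.PropositionalEquality using (_≡_)
open import Relation.Nullary.Decidable using (⌊_⌋)

countTrue : {X : Set} → (X → Bool) → List X → ℕ
countTrue p [] = 0
countTrue p (x ∷ xs) = (if p x then 1 else 0) + countTrue p xs

-- A bipartite graph with parts A and B (finite, enumerated by lists
-- without repetition) is given by its edge predicate E : A → B → Bool.
-- Degree of a ∈ A and of b ∈ B:
degA : {A B : Set} → List B → (A → B → Bool) → A → ℕ
degA enumB E a = countTrue (λ b → E a b) enumB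

degB : {A B : Set} → List A → (A → B → Bool) → B → ℕ
degB enumA E b = countTrue (λ a → E a b) enumA

IsRegular : {A B : Set} → List A → List B → (A → B → Bool) → ℕ → Set
IsRegular enumA enumB E d =
  ((a : _) → degA enumB E a ≡ d) × ((b : _) → degB enumA E b ≡ d)

-- A balanced bipartite graph with a given vertex ordering and part size n:
-- A = {a_1..a_n}, B = {b_1..b_n} indexed by Fin n; the edge a_i b_j is E i j.
BBGraph : ℕ → Set
BBGraph n = Fin n → Fin n → Bool

RegularBB : (n : ℕ) → BBGraph n → ℕ → Set
RegularBB n E d = IsRegular (allFin n) (allFin n) E d

MatchingOrdering : (n : ℕ) → BBGraph n → Set
MatchingOrdering n E = (i : Fin n) → E i i ≡ true

ComatchingOrdering : (n : ℕ) → BBGraph n → Set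
ComatchingOrdering n E = (i : Fin n) → E i i ≡ false

-- Balanced bipartite product H1 ⋈ H2: parts A1 × A2 and B1 × B2 (both
-- indexed by Fin n1 × Fin n2); (a_i, a2)(b_j, b2) is an edge iff
-- (i = j and a2 b2 ∈ E2) or (a_i b_j ∈ E1 and a2 = b2 as indices).
bowtie : {n₁ n₂ : ℕ} → BBGraph n₁ → BBGraph n₂ →
         (Fin n₁ × Fin n₂) → (Fin n₁ × Fin n₂) → Bool
bowtie E₁ E₂ (i , k) (j , l) = (⌊ i ≟ j ⌋ ∧ E₂ k l) ∨ (E₁ i j ∧ ⌊ k ≟ l ⌋)

pairs : (n₁ n₂ : ℕ) → List (Fin n₁ × Fin n₂)
pairs n₁ n₂ = cartesianProduct (allFin n₁) (allFin n₂)

module Submission where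

-- The neighbourhood of (a_i, a_k) in H₁ ⋈ H₂ is the union of {b_i} × N(a_k) and
-- N(a_i) × {b_k}, so by inclusion–exclusion its size is d₂ + d₁ minus the size of the
-- intersection. That intersection is {(b_i, b_k)} when a_i b_i and a_k b_k are both edges
-- and empty otherwise, so exactly one common neighbour is lost when both orderings are
-- matchings and none when one of them is a comatching.

open import Defs
open import Algebra.Bundles using (CommutativeMonoid)
open import Data.Bool using (Bool; true; false; _∧_; _∨_; if_then_else_)
open import Data.Bool.Properties using (∧-comm; ∧-identityʳ; ∧-commutativeMonoid)
open import Data.Empty using (⊥-elim)
open import Data.Fin using (Fin; zero; suc)
open import Data.Fin.Properties using (_≟_)
open import Data.List using (List; []; _∷_; length; _++_; map; tabulate; allFin; cartesianProduct)
open import Data.List.Properties using (length-++; length-map; length-tabulate)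
open import Data.Nat using (ℕ; suc; _+_; _∸_; _*_; _≤_)
open import Data.Nat.Properties using (+-identityʳ; +-suc; +-assoc; +-comm; *-identityˡ; *-identityʳ; *-zeroʳ; *-distribʳ-+; m+n∸n≡m)
open import Data.Product using (_×_; _,_; proj₁; proj₂)
open import Data.Sum using (_⊎_; inj₁; inj₂)
open import Function using (_∘_; id; flip)
open import Relation.Nullary using (¬_; yes; no)
open import Relation.Nullary.Decidable using (⌊_⌋)
open import Relation.Binary.PropositionalEquality using (_≡_; refl; sym; trans; cong; cong₂; module ≡-Reasoning)

open import Algebra.Properties.CommutativeSemigroup
  (CommutativeMonoid.commutativeSemigroup ∧-commutativeMonoid) using (interchange)

indicator : Bool → ℕ
indicator b = if b then 1 else 0

private variable X Y : Set

countTrue-cong : {p q : X → Bool} → (∀ x → p x ≡ q x) → ∀ xs → countTrue p xs ≡ countTrue q xs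
countTrue-cong p≗q []       = refl
countTrue-cong p≗q (x ∷ xs) = cong₂ _+_ (cong indicator (p≗q x)) (countTrue-cong p≗q xs)

countTrue-false : ∀ xs → countTrue {X = X} (λ _ → false) xs ≡ 0
countTrue-false []       = refl
countTrue-false (x ∷ xs) = countTrue-false xs

countTrue-++ : ∀ (p : X → Bool) xs ys → countTrue p (xs ++ ys) ≡ countTrue p xs + countTrue p ys
countTrue-++ p []       ys = refl
countTrue-++ p (x ∷ xs) ys =
  trans (cong (indicator (p x) +_) (countTrue-++ p xs ys)) (sym (+-assoc (indicator (p x)) _ _))

countTrue-map : ∀ (p : Y → Bool) (f : X → Y) xs → countTrue p (map f xs) ≡ countTrue (p ∘ f) xs
countTrue-map p f []       = refl
countTrue-map p f (x ∷ xs) = cong (indicator (p (f x)) +_) (countTrue-map p f xs)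

countTrue-const-∧ : ∀ b (p : X → Bool) xs → countTrue (λ x → b ∧ p x) xs ≡ indicator b * countTrue p xs
countTrue-const-∧ true  p xs = sym (+-identityʳ _)
countTrue-const-∧ false p xs = countTrue-false xs

countTrue-∨+countTrue-∧ : ∀ (p q : X → Bool) xs →
  countTrue (λ x → p x ∨ q x) xs + countTrue (λ x → p x ∧ q x) xs ≡ countTrue p xs + countTrue q xs
countTrue-∨+countTrue-∧ p q [] = refl
countTrue-∨+countTrue-∧ p q (x ∷ xs) with p x | q x
... | true  | true  = cong suc (begin
  countTrue _ xs + suc (countTrue _ xs) ≡⟨ +-suc (countTrue _ xs) _ ⟩
  suc (countTrue _ xs + countTrue _ xs) ≡⟨ cong suc (countTrue-∨+countTrue-∧ p q xs) ⟩
  suc (countTrue p xs + countTrue q xs) ≡⟨ +-suc (countTrue p xs) _ ⟨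
  countTrue p xs + suc (countTrue q xs) ∎)
  where open ≡-Reasoning
... | true  | false = cong suc (countTrue-∨+countTrue-∧ p q xs)
... | false | true  = trans (cong suc (countTrue-∨+countTrue-∧ p q xs)) (sym (+-suc (countTrue p xs) _))
... | false | false = countTrue-∨+countTrue-∧ p q xs

countTrue-cartesianProduct : ∀ (p : X → Bool) (q : Y → Bool) xs ys →
  countTrue (λ z → p (proj₁ z) ∧ q (proj₂ z)) (cartesianProduct xs ys) ≡ countTrue p xs * countTrue q ys
countTrue-cartesianProduct p q []       ys = refl
countTrue-cartesianProduct {X = X} {Y = Y} p q (x ∷ xs) ys = begin
  countTrue r (map (x ,_) ys ++ cartesianProduct xs ys)
    ≡⟨ countTrue-++ r (map (x ,_) ys) (cartesianProduct xs ys) ⟩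
  countTrue r (map (x ,_) ys) + countTrue r (cartesianProduct xs ys)
    ≡⟨ cong₂ _+_ (trans (countTrue-map r (x ,_) ys) (countTrue-const-∧ (p x) q ys))
                 (countTrue-cartesianProduct p q xs ys) ⟩
  indicator (p x) * countTrue q ys + countTrue p xs * countTrue q ys
    ≡⟨ *-distribʳ-+ (countTrue q ys) (indicator (p x)) (countTrue p xs) ⟨
  countTrue p (x ∷ xs) * countTrue q ys ∎
  where
    open ≡-Reasoning
    r : X × Y → Bool
    r z = p (proj₁ z) ∧ q (proj₂ z)

length-cartesianProduct : ∀ (xs : List X) (ys : List Y) →
  length (cartesianProduct xs ys) ≡ length xs * length ys
length-cartesianProduct []       ys = refl
length-cartesianProduct (x ∷ xs) ys =
  trans (length-++ (map (x ,_) ys)) (cong₂ _+_ (length-map (x ,_) ys) (length-cartesianProduct xs ys))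

countTrue-tabulate : ∀ {n} (p : X → Bool) (f : Fin n → X) →
  countTrue p (tabulate f) ≡ countTrue (p ∘ f) (allFin n)
countTrue-tabulate {n = ℕ.zero} p f = refl
countTrue-tabulate {n = suc n}  p f =
  cong (indicator (p (f zero)) +_)
       (trans (countTrue-tabulate p (f ∘ suc)) (sym (countTrue-tabulate (p ∘ f) suc)))

⌊≟⌋-sym : ∀ {n} (i j : Fin n) → ⌊ i ≟ j ⌋ ≡ ⌊ j ≟ i ⌋
⌊≟⌋-sym i j with i ≟ j | j ≟ i
... | yes _   | yes _   = refl
... | no  _   | no  _   = refl
... | yes i≡j | no  j≢i = ⊥-elim (j≢i (sym i≡j))
... | no  i≢j | yes j≡i = ⊥-elim (i≢j (sym j≡i))

⌊suc≟suc⌋ : ∀ {n} (i j : Fin n) → ⌊ suc i ≟ suc j ⌋ ≡ ⌊ i ≟ j ⌋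
⌊suc≟suc⌋ i j with i ≟ j
... | yes _ = refl
... | no  _ = refl

countTrue-≟-∧ : ∀ {n} (i : Fin n) (p : Fin n → Bool) →
  countTrue (λ j → ⌊ i ≟ j ⌋ ∧ p j) (allFin n) ≡ indicator (p i)
countTrue-≟-∧ {suc n} zero p = begin
  indicator (p zero) + countTrue (λ j → ⌊ zero ≟ j ⌋ ∧ p j) (tabulate suc)
    ≡⟨ cong (indicator (p zero) +_) (countTrue-tabulate (λ j → ⌊ zero ≟ j ⌋ ∧ p j) suc) ⟩
  indicator (p zero) + countTrue (λ _ → false) (allFin n)
    ≡⟨ cong (indicator (p zero) +_) (countTrue-false (allFin n)) ⟩
  indicator (p zero) + 0
    ≡⟨ +-identityʳ (indicator (p zero)) ⟩
  indicator (p zero) ∎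
  where open ≡-Reasoning
countTrue-≟-∧ {suc n} (suc i) p = begin
  countTrue (λ j → ⌊ suc i ≟ j ⌋ ∧ p j) (tabulate suc)
    ≡⟨ countTrue-tabulate (λ j → ⌊ suc i ≟ j ⌋ ∧ p j) suc ⟩
  countTrue (λ j → ⌊ suc i ≟ suc j ⌋ ∧ p (suc j)) (allFin n)
    ≡⟨ countTrue-cong (λ j → cong (_∧ p (suc j)) (⌊suc≟suc⌋ i j)) (allFin n) ⟩
  countTrue (λ j → ⌊ i ≟ j ⌋ ∧ p (suc j)) (allFin n)
    ≡⟨ countTrue-≟-∧ i (p ∘ suc) ⟩
  indicator (p (suc i)) ∎
  where open ≡-Reasoning

countTrue-≟ : ∀ {n} (i : Fin n) → countTrue (λ j → ⌊ i ≟ j ⌋) (allFin n) ≡ 1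
countTrue-≟ i =
  trans (countTrue-cong (λ j → sym (∧-identityʳ ⌊ i ≟ j ⌋)) (allFin _)) (countTrue-≟-∧ i (λ _ → true))

module _ {n₁ n₂ : ℕ} (E₁ : BBGraph n₁) (E₂ : BBGraph n₂) where

  degA-bowtie : ∀ i k →
    degA (pairs n₁ n₂) (bowtie E₁ E₂) (i , k) + indicator (E₁ i i) * indicator (E₂ k k)
      ≡ degA (allFin n₁) E₁ i + degA (allFin n₂) E₂ k
  degA-bowtie i k = begin
    countTrue (λ z → F z ∨ G z) P + indicator (E₁ i i) * indicator (E₂ k k)
      ≡⟨ cong (countTrue (λ z → F z ∨ G z) P +_) F∧G-count ⟨
    countTrue (λ z → F z ∨ G z) P + countTrue (λ z → F z ∧ G z) P
      ≡⟨ countTrue-∨+countTrue-∧ F G P ⟩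
    countTrue F P + countTrue G P
      ≡⟨ cong₂ _+_ F-count G-count ⟩
    degA (allFin n₂) E₂ k + degA (allFin n₁) E₁ i
      ≡⟨ +-comm (degA (allFin n₂) E₂ k) (degA (allFin n₁) E₁ i) ⟩
    degA (allFin n₁) E₁ i + degA (allFin n₂) E₂ k ∎
    where
      open ≡-Reasoning
      P = pairs n₁ n₂
      F G : Fin n₁ × Fin n₂ → Bool
      F (j , l) = ⌊ i ≟ j ⌋ ∧ E₂ k l
      G (j , l) = E₁ i j ∧ ⌊ k ≟ l ⌋

      F-count : countTrue F P ≡ degA (allFin n₂) E₂ k
      F-count = trans (countTrue-cartesianProduct (λ j → ⌊ i ≟ j ⌋) (E₂ k) (allFin n₁) (allFin n₂))
                      (trans (cong (_* degA (allFin n₂) E₂ k) (countTrue-≟ i)) (*-identityˡ _))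

      G-count : countTrue G P ≡ degA (allFin n₁) E₁ i
      G-count = trans (countTrue-cartesianProduct (E₁ i) (λ l → ⌊ k ≟ l ⌋) (allFin n₁) (allFin n₂))
                      (trans (cong (degA (allFin n₁) E₁ i *_) (countTrue-≟ k)) (*-identityʳ _))

      F∧G-count : countTrue (λ z → F z ∧ G z) P ≡ indicator (E₁ i i) * indicator (E₂ k k)
      F∧G-count = begin
        countTrue (λ z → F z ∧ G z) P
          ≡⟨ countTrue-cong (λ { (j , l) → trans (interchange ⌊ i ≟ j ⌋ (E₂ k l) (E₁ i j) ⌊ k ≟ l ⌋)
                                                  (cong ((⌊ i ≟ j ⌋ ∧ E₁ i j) ∧_) (∧-comm (E₂ k l) ⌊ k ≟ l ⌋)) }) P ⟩
        countTrue (λ z → (⌊ i ≟ proj₁ z ⌋ ∧ E₁ i (proj₁ z)) ∧ (⌊ k ≟ proj₂ z ⌋ ∧ E₂ k (proj₂ z))) P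
          ≡⟨ countTrue-cartesianProduct _ _ (allFin n₁) (allFin n₂) ⟩
        countTrue (λ j → ⌊ i ≟ j ⌋ ∧ E₁ i j) (allFin n₁) * countTrue (λ l → ⌊ k ≟ l ⌋ ∧ E₂ k l) (allFin n₂)
          ≡⟨ cong₂ _*_ (countTrue-≟-∧ i (E₁ i)) (countTrue-≟-∧ k (E₂ k)) ⟩
        indicator (E₁ i i) * indicator (E₂ k k) ∎

-- B-side degrees of H₁ ⋈ H₂ are A-side degrees of the product of the transposed graphs.
degB-bowtie : ∀ {n₁ n₂} (E₁ : BBGraph n₁) (E₂ : BBGraph n₂) j l →
  degB (pairs n₁ n₂) (bowtie E₁ E₂) (j , l) + indicator (E₁ j j) * indicator (E₂ l l)
    ≡ degB (allFin n₁) E₁ j + degB (allFin n₂) E₂ l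
degB-bowtie {n₁} {n₂} E₁ E₂ j l =
  trans (cong (_+ indicator (E₁ j j) * indicator (E₂ l l)) (countTrue-cong bowtie-transpose (pairs n₁ n₂)))
        (degA-bowtie (flip E₁) (flip E₂) j l)
  where
    bowtie-transpose : ∀ z → bowtie E₁ E₂ z (j , l) ≡ bowtie (flip E₁) (flip E₂) (j , l) z
    bowtie-transpose (i , k) =
      cong₂ (λ x y → (x ∧ E₂ k l) ∨ (E₁ i j ∧ y)) (⌊≟⌋-sym i j) (⌊≟⌋-sym k l)

bowtie-regular : ∀ {n₁ n₂ d₁ d₂} (E₁ : BBGraph n₁) (E₂ : BBGraph n₂) (c : ℕ) →
  RegularBB n₁ E₁ d₁ → RegularBB n₂ E₂ d₂ →
  (∀ i k → indicator (E₁ i i) * indicator (E₂ k k) ≡ c) →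
  IsRegular (pairs n₁ n₂) (pairs n₁ n₂) (bowtie E₁ E₂) (d₁ + d₂ ∸ c)
bowtie-regular E₁ E₂ c (regA₁ , regB₁) (regA₂ , regB₂) diagonal =
    (λ { (i , k) → cancel (trans (cong (_ +_) (sym (diagonal i k)))
                                 (trans (degA-bowtie E₁ E₂ i k) (cong₂ _+_ (regA₁ i) (regA₂ k)))) })
  , (λ { (j , l) → cancel (trans (cong (_ +_) (sym (diagonal j l)))
                                 (trans (degB-bowtie E₁ E₂ j l) (cong₂ _+_ (regB₁ j) (regB₂ l)))) })
  where
    cancel : ∀ {x d} → x + c ≡ d → x ≡ d ∸ c
    cancel {x} x+c≡d = trans (sym (m+n∸n≡m x c)) (cong (_∸ c) x+c≡d)

diagonal-vanishes : ∀ {n₁ n₂} (E₁ : BBGraph n₁) (E₂ : BBGraph n₂) →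
  (MatchingOrdering n₁ E₁ ⊎ ComatchingOrdering n₁ E₁) →
  (MatchingOrdering n₂ E₂ ⊎ ComatchingOrdering n₂ E₂) →
  ¬ (MatchingOrdering n₁ E₁ × MatchingOrdering n₂ E₂) →
  ∀ i k → indicator (E₁ i i) * indicator (E₂ k k) ≡ 0
diagonal-vanishes _ _ (inj₁ m₁) (inj₁ m₂) notBoth i k = ⊥-elim (notBoth (m₁ , m₂))
diagonal-vanishes _ E₂ (inj₂ c₁) _ _ i k = cong (λ b → indicator b * indicator (E₂ k k)) (c₁ i)
diagonal-vanishes E₁ _ (inj₁ _) (inj₂ c₂) _ i k =
  trans (cong (λ b → indicator (E₁ i i) * indicator b) (c₂ k)) (*-zeroʳ (indicator (E₁ i i)))

proposition7 : (n₁ n₂ d₁ d₂ : ℕ) → 1 ≤ n₁ → 1 ≤ n₂ → 1 ≤ d₁ → 1 ≤ d₂ →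
    (E₁ : BBGraph n₁) → (E₂ : BBGraph n₂) →
    RegularBB n₁ E₁ d₁ → RegularBB n₂ E₂ d₂ →
    (MatchingOrdering n₁ E₁ ⊎ ComatchingOrdering n₁ E₁) →
    (MatchingOrdering n₂ E₂ ⊎ ComatchingOrdering n₂ E₂) →
    (length (pairs n₁ n₂) ≡ n₁ * n₂)
    × (MatchingOrdering n₁ E₁ × MatchingOrdering n₂ E₂ →
        IsRegular (pairs n₁ n₂) (pairs n₁ n₂) (bowtie E₁ E₂) (d₁ + d₂ ∸ 1))
    × (¬ (MatchingOrdering n₁ E₁ × MatchingOrdering n₂ E₂) →
        IsRegular (pairs n₁ n₂) (pairs n₁ n₂) (bowtie E₁ E₂) (d₁ + d₂))
proposition7 n₁ n₂ d₁ d₂ _ _ _ _ E₁ E₂ reg₁ reg₂ order₁ order₂ =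
    trans (length-cartesianProduct (allFin n₁) (allFin n₂))
          (cong₂ _*_ (length-tabulate {n = n₁} id) (length-tabulate {n = n₂} id))
  , (λ { (m₁ , m₂) → bowtie-regular E₁ E₂ 1 reg₁ reg₂
                        (λ i k → cong₂ (λ a b → indicator a * indicator b) (m₁ i) (m₂ k)) })
  , (λ notBoth → bowtie-regular E₁ E₂ 0 reg₁ reg₂ (diagonal-vanishes E₁ E₂ order₁ order₂ notBoth))
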